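{- For integers $0\le d\le n$ define $$g_{n,d}(t)=\sum_{i=1}^{\min(d,n-d)} \frac{(n-i-1)!}{(d-i)!\,(n-d-i)!\,(i-1)!}\, t^i$$ (empty sum $=0$; in particular $g_{0,0}(t)=g_{1,0}(t)=0$). Then for every $d\ge 1$: $$g_{2d+2,d+1}(t)=\frac{(t+2)(2d-1)}{d}\, g_{2d,d}(t)-\frac{(d-1)t^2}{d}\, g_{2d-2,d-1}(t),$$ $$g_{2d+3,d+1}(t)=\frac{2(2d^2t+4d^2-1)}{(d+1)(2d-1)}\, g_{2d+1,d}(t)-\frac{(2d+1)(d-1)t^2}{(d+1)(2d-1)}\, g_{2d-1,d-1}(t),$$ $$g_{2d+1,d}(t)=\frac{2d-1}{d}\, g_{2d,d}(t)+\frac{(d-1)t}{d}\, g_{2d-1,d-1}(t),$$ $$g_{2d+2,d+1}(t)=2\, g_{2d+1,d}(t)+t\, g_{2d,d}(t).$$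
   Context: $g_{n,d}$ is Speyer's $g$-polynomial of the uniform matroid $U_{n,d}$. -}

module Defs where

open import Data.Nat using (ℕ; zero; suc; _∸_; _≤ᵇ_; _⊓_; _!)
import Data.Nat as ℕ
open import Data.Bool using (if_then_else_; _∧_)
open import Data.Integer using (+_)
open import Data.Rational using (ℚ; 0ℚ; _+_; _*_; _/_)
open import Data.Rational as Q using ()

-- Polynomials in t with rational coefficients, as coefficient sequences
-- (p k = coefficient of t^k).
Poly : Set
Poly = ℕ → ℚ

-- Total division of a rational by a natural number (convention q / 0 = 0;
-- it is only ever used with nonzero denominators in the statement).
_/ℕ_ : ℚ → ℕ → ℚ
q /ℕ zero  = 0ℚ
q /ℕ suc m = q * ((+ 1) / suc m)

ℕ→ℚ : ℕ → ℚ
ℕ→ℚ n = (+ n) / 1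

_·ₚ_ : ℚ → Poly → Poly
(c ·ₚ p) k = c * p k

_+ₚ_ : Poly → Poly → Poly
(p +ₚ q) k = p k + q k

_-ₚ_ : Poly → Poly → Poly
(p -ₚ q) k = p k Q.- q k

t·_ : Poly → Poly
(t· p) zero    = 0ℚ
(t· p) (suc k) = p k

infixr 7 _·ₚ_ t·_
infixl 6 _+ₚ_ _-ₚ_

g : ℕ → ℕ → Poly
g n d i =
  if (1 ≤ᵇ i) ∧ (i ≤ᵇ d ⊓ (n ∸ d))
  then ℕ→ℚ ((n ∸ i ∸ 1) !) /ℕ (((d ∸ i) !) ℕ.* ((n ∸ d ∸ i) !) ℕ.* ((i ∸ 1) !))
  else 0ℚ

open import Relation.Binary.PropositionalEquality using (_≡_)
_≈ₚ_ : Poly → Poly → Set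
p ≈ₚ q = ∀ k → p k ≡ q k
infix 4 _≈ₚ_

-- The coefficient of t^i in g_{n,d} is the trinomial coefficient
-- T(d-i, n-d-i, i-1) = (n-i-1)! / ((d-i)! (n-d-i)! (i-1)!). Cleared of denominators,
-- identities (3) and (4) therefore compare trinomial coefficients with neighbouring
-- indices, and both follow from the absorption rules (a+1) T(a+1,b,c) = (a+b+c+1) T(a,b,c)
-- (likewise in b and c). Identities (1) and (2) are linear combinations of (3) and (4)
-- at consecutive values of d and of their shifts by t. All of this holds over ℕ; only
-- the final division by the leading coefficient takes place in ℚ.
module Submission where

open import Defs
open import Data.Nat
import Data.Nat as ℕ
open import Data.Nat.Properties
open import Data.Nat.Combinatorics using (_C_; nCk≡n!/k![n-k]!; k![n∸k]!∣n!)
open import Data.Nat.DivMod using (m/n*n≡m)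
open import Data.Nat.Tactic.RingSolver using (solve-∀)
open import Data.Bool using (true; false)
open import Data.Integer as ℤ using (+_)
import Data.Integer.Properties as ℤ
open import Data.Rational as ℚ using (1ℚ; toℚᵘ)
import Data.Rational.Properties as ℚ
import Data.Rational.Unnormalised as ℚᵘ
import Data.Rational.Unnormalised.Properties as ℚᵘ
open import Data.Rational.Solver using (module +-*-Solver)
open import Data.Product using (_×_; _,_)
open import Relation.Nullary using (yes; no; ¬_; contradiction)
open import Relation.Nullary.Reflects using (ofʸ; ofⁿ)
open import Relation.Binary.PropositionalEquality
open import Algebra.Properties.CommutativeSemigroup *-commutativeSemigroup using (x∙yz≈y∙xz)

-- ℕ→ℚ n is a normalised fraction, so its arithmetic is read off in ℚᵘ,
-- where n / 1 is literally mkℚᵘ (+ n) 0.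
ℕ→ℚᵘ : ℕ → ℚᵘ.ℚᵘ
ℕ→ℚᵘ n = ℚᵘ.mkℚᵘ (+ n) 0

toℚᵘ-ℕ→ℚ : ∀ n → toℚᵘ (ℕ→ℚ n) ℚᵘ.≃ ℕ→ℚᵘ n
toℚᵘ-ℕ→ℚ n = ℚ.toℚᵘ-fromℚᵘ (ℕ→ℚᵘ n)

ℕ→ℚ-+ : ∀ m n → ℕ→ℚ (m + n) ≡ ℕ→ℚ m ℚ.+ ℕ→ℚ n
ℕ→ℚ-+ m n = ℚ.toℚᵘ-injective (begin
  toℚᵘ (ℕ→ℚ (m + n))                ≈⟨ toℚᵘ-ℕ→ℚ (m + n) ⟩
  ℕ→ℚᵘ (m + n)                      ≈⟨ ℚᵘ.*≡* (cong (ℤ._* + 1) numerators) ⟩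
  ℕ→ℚᵘ m ℚᵘ.+ ℕ→ℚᵘ n                ≈⟨ ℚᵘ.+-cong (toℚᵘ-ℕ→ℚ m) (toℚᵘ-ℕ→ℚ n) ⟨
  toℚᵘ (ℕ→ℚ m) ℚᵘ.+ toℚᵘ (ℕ→ℚ n)    ≈⟨ ℚ.toℚᵘ-homo-+ (ℕ→ℚ m) (ℕ→ℚ n) ⟨
  toℚᵘ (ℕ→ℚ m ℚ.+ ℕ→ℚ n)            ∎)
  where
  open ℚᵘ.≃-Reasoning
  numerators : + (m + n) ≡ + m ℤ.* + 1 ℤ.+ + n ℤ.* + 1
  numerators = trans (ℤ.pos-+ m n) (sym (cong₂ ℤ._+_ (ℤ.*-identityʳ (+ m)) (ℤ.*-identityʳ (+ n))))

ℕ→ℚ-* : ∀ m n → ℕ→ℚ (m * n) ≡ ℕ→ℚ m ℚ.* ℕ→ℚ n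
ℕ→ℚ-* m n = ℚ.toℚᵘ-injective (begin
  toℚᵘ (ℕ→ℚ (m * n))                ≈⟨ toℚᵘ-ℕ→ℚ (m * n) ⟩
  ℕ→ℚᵘ (m * n)                      ≈⟨ ℚᵘ.*≡* (cong (ℤ._* + 1) (ℤ.pos-* m n)) ⟩
  ℕ→ℚᵘ m ℚᵘ.* ℕ→ℚᵘ n                ≈⟨ ℚᵘ.*-cong (toℚᵘ-ℕ→ℚ m) (toℚᵘ-ℕ→ℚ n) ⟨
  toℚᵘ (ℕ→ℚ m) ℚᵘ.* toℚᵘ (ℕ→ℚ n)    ≈⟨ ℚ.toℚᵘ-homo-* (ℕ→ℚ m) (ℕ→ℚ n) ⟨
  toℚᵘ (ℕ→ℚ m ℚ.* ℕ→ℚ n)            ∎)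
  where open ℚᵘ.≃-Reasoning

ℕ→ℚ-inverse : ∀ m → ℕ→ℚ (suc m) ℚ.* (+ 1 ℚ./ suc m) ≡ 1ℚ
ℕ→ℚ-inverse m = ℚ.toℚᵘ-injective (begin
  toℚᵘ (ℕ→ℚ (suc m) ℚ.* r)               ≈⟨ ℚ.toℚᵘ-homo-* (ℕ→ℚ (suc m)) r ⟩
  toℚᵘ (ℕ→ℚ (suc m)) ℚᵘ.* toℚᵘ r          ≈⟨ ℚᵘ.*-cong (toℚᵘ-ℕ→ℚ (suc m)) (ℚ.toℚᵘ-fromℚᵘ (ℚᵘ.mkℚᵘ (+ 1) m)) ⟩
  ℕ→ℚᵘ (suc m) ℚᵘ.* ℚᵘ.1/ ℕ→ℚᵘ (suc m)    ≈⟨ ℚᵘ.*-inverseʳ (ℕ→ℚᵘ (suc m)) ⟩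
  ℚᵘ.1ℚᵘ                                  ∎)
  where
  open ℚᵘ.≃-Reasoning
  r = + 1 ℚ./ suc m

open ≡-Reasoning

ℕ→ℚ-linear : ∀ a x b y → ℕ→ℚ (a * x + b * y) ≡ ℕ→ℚ a ℚ.* ℕ→ℚ x ℚ.+ ℕ→ℚ b ℚ.* ℕ→ℚ y
ℕ→ℚ-linear a x b y = trans (ℕ→ℚ-+ (a * x) (b * y)) (cong₂ ℚ._+_ (ℕ→ℚ-* a x) (ℕ→ℚ-* b y))

ℕ→ℚ-*-/ℕ : ∀ x p .{{_ : NonZero p}} → ℕ→ℚ (x * p) /ℕ p ≡ ℕ→ℚ x
ℕ→ℚ-*-/ℕ x (suc m) = begin
  ℕ→ℚ (x * suc m) ℚ.* r             ≡⟨ cong (ℚ._* r) (ℕ→ℚ-* x (suc m)) ⟩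
  ℕ→ℚ x ℚ.* ℕ→ℚ (suc m) ℚ.* r       ≡⟨ ℚ.*-assoc (ℕ→ℚ x) (ℕ→ℚ (suc m)) r ⟩
  ℕ→ℚ x ℚ.* (ℕ→ℚ (suc m) ℚ.* r)     ≡⟨ cong (ℕ→ℚ x ℚ.*_) (ℕ→ℚ-inverse m) ⟩
  ℕ→ℚ x ℚ.* 1ℚ                      ≡⟨ ℚ.*-identityʳ (ℕ→ℚ x) ⟩
  ℕ→ℚ x                             ∎
  where r = + 1 ℚ./ suc m

ℕ→ℚ-solve-+ : ∀ D {x w u} α β .{{_ : NonZero D}} → D * x ≡ α * w + β * u →
              ℕ→ℚ x ≡ (ℕ→ℚ α /ℕ D) ℚ.* ℕ→ℚ w ℚ.+ (ℕ→ℚ β /ℕ D) ℚ.* ℕ→ℚ u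
ℕ→ℚ-solve-+ (suc m) {x} {w} {u} α β eq = sym (begin
  a ℚ.* r ℚ.* w′ ℚ.+ b ℚ.* r ℚ.* u′
    ≡⟨ solve 5 (λ a r w b u → a :* r :* w :+ b :* r :* u := r :* (a :* w :+ b :* u)) refl a r w′ b u′ ⟩
  r ℚ.* (a ℚ.* w′ ℚ.+ b ℚ.* u′)
    ≡⟨ cong (r ℚ.*_) eqℚ ⟨
  r ℚ.* (δ ℚ.* x′)
    ≡⟨ solve 3 (λ r δ x → r :* (δ :* x) := δ :* r :* x) refl r δ x′ ⟩
  δ ℚ.* r ℚ.* x′
    ≡⟨ cong (ℚ._* x′) (ℕ→ℚ-inverse m) ⟩
  1ℚ ℚ.* x′
    ≡⟨ ℚ.*-identityˡ x′ ⟩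
  x′
    ∎)
  where
  open +-*-Solver
  r = + 1 ℚ./ suc m
  a = ℕ→ℚ α ; b = ℕ→ℚ β ; δ = ℕ→ℚ (suc m) ; x′ = ℕ→ℚ x ; w′ = ℕ→ℚ w ; u′ = ℕ→ℚ u
  eqℚ : δ ℚ.* x′ ≡ a ℚ.* w′ ℚ.+ b ℚ.* u′
  eqℚ = trans (sym (ℕ→ℚ-* (suc m) x)) (trans (cong ℕ→ℚ eq) (ℕ→ℚ-linear α w β u))

ℕ→ℚ-solve-− : ∀ D {x w u} α β .{{_ : NonZero D}} → D * x + β * u ≡ α * w →
              ℕ→ℚ x ≡ (ℕ→ℚ α /ℕ D) ℚ.* ℕ→ℚ w ℚ.- (ℕ→ℚ β /ℕ D) ℚ.* ℕ→ℚ u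
ℕ→ℚ-solve-− (suc m) {x} {w} {u} α β eq = sym (begin
  a ℚ.* r ℚ.* w′ ℚ.- b ℚ.* r ℚ.* u′
    ≡⟨ solve 5 (λ a r w b u → a :* r :* w :- b :* r :* u := r :* (a :* w) :- r :* (b :* u)) refl a r w′ b u′ ⟩
  r ℚ.* (a ℚ.* w′) ℚ.- r ℚ.* (b ℚ.* u′)
    ≡⟨ cong (λ z → r ℚ.* z ℚ.- r ℚ.* (b ℚ.* u′)) eqℚ ⟨
  r ℚ.* (δ ℚ.* x′ ℚ.+ b ℚ.* u′) ℚ.- r ℚ.* (b ℚ.* u′)
    ≡⟨ solve 5 (λ r δ x b u → r :* (δ :* x :+ b :* u) :- r :* (b :* u) := δ :* r :* x) refl r δ x′ b u′ ⟩
  δ ℚ.* r ℚ.* x′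
    ≡⟨ cong (ℚ._* x′) (ℕ→ℚ-inverse m) ⟩
  1ℚ ℚ.* x′
    ≡⟨ ℚ.*-identityˡ x′ ⟩
  x′
    ∎)
  where
  open +-*-Solver
  r = + 1 ℚ./ suc m
  a = ℕ→ℚ α ; b = ℕ→ℚ β ; δ = ℕ→ℚ (suc m) ; x′ = ℕ→ℚ x ; w′ = ℕ→ℚ w ; u′ = ℕ→ℚ u
  eqℚ : δ ℚ.* x′ ℚ.+ b ℚ.* u′ ≡ a ℚ.* w′
  eqℚ = trans (sym (ℕ→ℚ-linear (suc m) x β u)) (trans (cong ℕ→ℚ eq) (ℕ→ℚ-* α w))

binomial-! : ∀ m n → ((m + n) C m) * (m ! * n !) ≡ (m + n) !
binomial-! m n = begin
  ((m + n) C m) * (m ! * n !)                                ≡⟨ cong (λ k → ((m + n) C m) * (m ! * k !)) (m+n∸m≡n m n) ⟨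
  ((m + n) C m) * (m ! * (m + n ∸ m) !)                      ≡⟨ cong (_* (m ! * (m + n ∸ m) !)) (nCk≡n!/k![n-k]! (m≤m+n m n)) ⟩
  (m + n) ! / (m ! * (m + n ∸ m) !) * (m ! * (m + n ∸ m) !)  ≡⟨ m/n*n≡m (k![n∸k]!∣n! (m≤m+n m n)) ⟩
  (m + n) !                                                  ∎
  where instance _ = m !* (m + n ∸ m) !≢0

trinomial : ℕ → ℕ → ℕ → ℕ
trinomial a b c = ((a + (b + c)) C a) * ((b + c) C b)

trinomial-! : ∀ a b c → trinomial a b c * (a ! * b ! * c !) ≡ (a + b + c) !
trinomial-! a b c = begin
  x * y * (a ! * b ! * c !)      ≡⟨ regroup x y (a !) (b !) (c !) ⟩
  x * (a ! * (y * (b ! * c !)))  ≡⟨ cong (λ z → x * (a ! * z)) (binomial-! b c) ⟩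
  x * (a ! * (b + c) !)          ≡⟨ binomial-! a (b + c) ⟩
  (a + (b + c)) !                ≡⟨ cong _! (+-assoc a b c) ⟨
  (a + b + c) !                  ∎
  where
  x = (a + (b + c)) C a
  y = (b + c) C b
  regroup : ∀ x y p q r → x * y * (p * q * r) ≡ x * (p * (y * (q * r)))
  regroup = solve-∀

factorials≢0 : ∀ a b c → NonZero (a ! * b ! * c !)
factorials≢0 a b c = m*n≢0 _ _ {{a !* b !≢0}} {{c !≢0}}

trinomial-absorption : ∀ {a b c a′ b′ c′} s → a′ + b′ + c′ ≡ suc (a + b + c) →
                       a′ ! * b′ ! * c′ ! ≡ s * (a ! * b ! * c !) →
                       s * trinomial a′ b′ c′ ≡ suc (a + b + c) * trinomial a b c
trinomial-absorption {a} {b} {c} {a′} {b′} {c′} s sum factorials =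
  *-cancelʳ-≡ _ _ p {{factorials≢0 a b c}} (begin
    s * t′ * p                 ≡⟨ *-assoc s t′ p ⟩
    s * (t′ * p)               ≡⟨ x∙yz≈y∙xz s t′ p ⟩
    t′ * (s * p)               ≡⟨ cong (t′ *_) factorials ⟨
    t′ * (a′ ! * b′ ! * c′ !)  ≡⟨ trinomial-! a′ b′ c′ ⟩
    (a′ + b′ + c′) !           ≡⟨ cong _! sum ⟩
    suc (a + b + c) !          ≡⟨ cong (suc (a + b + c) *_) (trinomial-! a b c) ⟨
    suc (a + b + c) * (t * p)  ≡⟨ *-assoc (suc (a + b + c)) t p ⟨
    suc (a + b + c) * t * p    ∎)
  where
  t = trinomial a b c
  t′ = trinomial a′ b′ c′
  p = a ! * b ! * c !

trinomial-absorption₁ : ∀ a b c → suc a * trinomial (suc a) b c ≡ suc (a + b + c) * trinomial a b c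
trinomial-absorption₁ a b c =
  trinomial-absorption {a} {b} {c} {suc a} {b} {c} (suc a) refl (regroup (suc a) (a !) (b !) (c !))
  where
  regroup : ∀ s x y z → s * x * y * z ≡ s * (x * y * z)
  regroup = solve-∀

trinomial-absorption₂ : ∀ a b c → suc b * trinomial a (suc b) c ≡ suc (a + b + c) * trinomial a b c
trinomial-absorption₂ a b c =
  trinomial-absorption {a} {b} {c} {a} {suc b} {c} (suc b) (cong (_+ c) (+-suc a b)) (regroup (suc b) (a !) (b !) (c !))
  where
  regroup : ∀ s x y z → x * (s * y) * z ≡ s * (x * y * z)
  regroup = solve-∀

trinomial-absorption₃ : ∀ a b c → suc c * trinomial a b (suc c) ≡ suc (a + b + c) * trinomial a b c
trinomial-absorption₃ a b c =
  trinomial-absorption {a} {b} {c} {a} {b} {suc c} (suc c) (+-suc (a + b) c) (regroup (suc c) (a !) (b !) (c !))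
  where
  regroup : ∀ s x y z → x * y * (s * z) ≡ s * (x * y * z)
  regroup = solve-∀

trinomial⁺ : ℕ → ℕ → ℕ → ℕ
trinomial⁺ (suc a) (suc b) (suc c) = trinomial a b c
trinomial⁺ _       _       _       = 0

trinomial-absorption₃⁺ : ∀ a b c → c * trinomial a b c ≡ (a + b + c) * trinomial⁺ (suc a) (suc b) c
trinomial-absorption₃⁺ a b zero    = sym (*-zeroʳ (a + b + 0))
trinomial-absorption₃⁺ a b (suc c) =
  trans (trinomial-absorption₃ a b c) (cong (_* trinomial a b c) (sym (+-suc (a + b) c)))

trinomial-diagonal : ∀ v c → trinomial (suc v) (suc v) c ≡ 2 * trinomial v (suc v) c + trinomial⁺ (2 + v) (2 + v) c
trinomial-diagonal v c = *-cancelˡ-≡ _ _ s (begin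
  s * y                      ≡⟨ split v c y ⟩
  2 * (suc v * y) + c * y    ≡⟨ cong₂ (λ p q → 2 * p + q) (trinomial-absorption₁ v (suc v) c)
                                                          (trinomial-absorption₃⁺ (suc v) (suc v) c) ⟩
  2 * (s * x) + s * z        ≡⟨ merge s x z ⟩
  s * (2 * x + z)            ∎)
  where
  s = suc v + suc v + c
  x = trinomial v (suc v) c
  y = trinomial (suc v) (suc v) c
  z = trinomial⁺ (2 + v) (2 + v) c
  split : ∀ v c y → (suc v + suc v + c) * y ≡ 2 * (suc v * y) + c * y
  split = solve-∀
  merge : ∀ s x z → 2 * (s * x) + s * z ≡ s * (2 * x + z)
  merge = solve-∀

trinomial-near-diagonal : ∀ u j → let e = u + j in
  suc e * trinomial u (suc u) j ≡ suc (e + e) * trinomial u u j + e * trinomial⁺ (suc u) (2 + u) j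
trinomial-near-diagonal u j = *-cancelˡ-≡ _ _ s (begin
  s * (suc e * x)                                ≡⟨ split u j x ⟩
  suc (e + e) * (suc u * x) + e * (j * x)        ≡⟨ cong₂ (λ p q → suc (e + e) * p + e * q) (trinomial-absorption₂ u u j)
                                                                                           (trinomial-absorption₃⁺ u (suc u) j) ⟩
  suc (e + e) * (s * y) + e * ((u + suc u + j) * z)  ≡⟨ merge u j y z ⟩
  s * (suc (e + e) * y + e * z)                  ∎)
  where
  e = u + j
  s = suc (u + u + j)
  x = trinomial u (suc u) j
  y = trinomial u u j
  z = trinomial⁺ (suc u) (2 + u) j
  split : ∀ u j x → suc (u + u + j) * (suc (u + j) * x) ≡ suc (u + j + (u + j)) * (suc u * x) + (u + j) * (j * x)
  split = solve-∀
  merge : ∀ u j y z → suc (u + j + (u + j)) * (suc (u + u + j) * y) + (u + j) * ((u + suc u + j) * z)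
                      ≡ suc (u + u + j) * (suc (u + j + (u + j)) * y + (u + j) * z)
  merge = solve-∀

-- gℕ d e k is the coefficient of t^k in g_{d+e,d}: the boundary zeros of trinomial⁺
-- encode the range 1 ≤ k ≤ min(d, e).
gℕ : ℕ → ℕ → ℕ → ℕ
gℕ d e k = trinomial⁺ (suc d ∸ k) (suc e ∸ k) k

shift : (ℕ → ℕ) → ℕ → ℕ
shift f zero    = 0
shift f (suc k) = f k

*0≡*0+*0 : ∀ a b c → a * 0 ≡ b * 0 + c * 0
*0≡*0+*0 = solve-∀

-- Over ℕ the identities are indexed by e = d - 1, so that no truncated subtraction occurs.
gℕ-central-step : ∀ e k → gℕ (2 + e) (2 + e) k ≡ 2 * gℕ (1 + e) (2 + e) k + shift (gℕ (1 + e) (1 + e)) k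
gℕ-central-step e zero          = refl
gℕ-central-step e (suc zero)    = trinomial-diagonal e 0
gℕ-central-step e (suc (suc i)) with i ≤? e
... | yes i≤e with e ∸ i | m∸n+n≡m i≤e
...   | u | refl rewrite m+n∸n≡m (suc u) i = inside u
  where
  inside : ∀ u → trinomial⁺ (suc u) (suc u) (2 + i) ≡ 2 * trinomial⁺ u (suc u) (2 + i) + trinomial⁺ (suc u) (suc u) (suc i)
  inside zero    = refl
  inside (suc v) = trinomial-diagonal v (suc i)
gℕ-central-step e (suc (suc i)) | no i≰e
  rewrite m≤n⇒m∸n≡0 (≰⇒> i≰e) | m≤n⇒m∸n≡0 (<⇒≤ (≰⇒> i≰e)) = refl

gℕ-near-central-step : ∀ e k → suc e * gℕ (1 + e) (2 + e) k ≡ suc (e + e) * gℕ (1 + e) (1 + e) k + e * shift (gℕ e (1 + e)) k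
gℕ-near-central-step e zero = *0≡*0+*0 (suc e) (suc (e + e)) e
gℕ-near-central-step e (suc j) with j ≤? e
... | yes j≤e with e ∸ j | m∸n+n≡m j≤e
...   | u | refl rewrite m+n∸n≡m (suc u) j | m+n∸n≡m (2 + u) j = trinomial-near-diagonal u j
gℕ-near-central-step e (suc j) | no j≰e
  rewrite m≤n⇒m∸n≡0 (≰⇒> j≰e) = *0≡*0+*0 (suc e) (suc (e + e)) e

shift-central-step : ∀ e k → shift (gℕ (2 + e) (2 + e)) k
                             ≡ 2 * shift (gℕ (1 + e) (2 + e)) k + shift (shift (gℕ (1 + e) (1 + e))) k
shift-central-step e zero    = refl
shift-central-step e (suc k) = gℕ-central-step e k

shift-near-central-step : ∀ e k → suc e * shift (gℕ (1 + e) (2 + e)) k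
                                  ≡ suc (e + e) * shift (gℕ (1 + e) (1 + e)) k + e * shift (shift (gℕ e (1 + e))) k
shift-near-central-step e zero    = gℕ-near-central-step e zero
shift-near-central-step e (suc k) = gℕ-near-central-step e k

-- (4) fails at d = 0 (g_{2,1} = t but g_{1,0} = g_{0,0} = 0), so at d = e it is only
-- used multiplied by e.
scaled-shift-central-step : ∀ e k → e * shift (gℕ (1 + e) (1 + e)) k
                                    ≡ e * (2 * shift (gℕ e (1 + e)) k + shift (shift (gℕ e e)) k)
scaled-shift-central-step zero    k = refl
scaled-shift-central-step (suc e) k = cong (suc e *_) (shift-central-step e k)

gℕ-central-recurrence : ∀ e k → suc e * gℕ (2 + e) (2 + e) k + e * shift (shift (gℕ e e)) k
                                ≡ suc (e + e) * (shift (gℕ (1 + e) (1 + e)) k + 2 * gℕ (1 + e) (1 + e) k)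
gℕ-central-recurrence e k = begin
  suc e * a₂ + e * tta₀
    ≡⟨ cong (λ x → suc e * x + e * tta₀) (gℕ-central-step e k) ⟩
  suc e * (2 * b₁ + ta₁) + e * tta₀
    ≡⟨ expand e b₁ ta₁ tta₀ ⟩
  2 * (suc e * b₁) + suc e * ta₁ + e * tta₀
    ≡⟨ cong (λ x → 2 * x + suc e * ta₁ + e * tta₀) (gℕ-near-central-step e k) ⟩
  2 * (suc (e + e) * a₁ + e * tb₀) + suc e * ta₁ + e * tta₀
    ≡⟨ regroup e a₁ tb₀ ta₁ tta₀ ⟩
  2 * suc (e + e) * a₁ + suc e * ta₁ + e * (2 * tb₀ + tta₀)
    ≡⟨ cong (λ x → 2 * suc (e + e) * a₁ + suc e * ta₁ + x) (scaled-shift-central-step e k) ⟨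
  2 * suc (e + e) * a₁ + suc e * ta₁ + e * ta₁
    ≡⟨ collect e a₁ ta₁ ⟩
  suc (e + e) * (ta₁ + 2 * a₁)
    ∎
  where
  a₂ = gℕ (2 + e) (2 + e) k
  a₁ = gℕ (1 + e) (1 + e) k
  b₁ = gℕ (1 + e) (2 + e) k
  ta₁ = shift (gℕ (1 + e) (1 + e)) k
  tb₀ = shift (gℕ e (1 + e)) k
  tta₀ = shift (shift (gℕ e e)) k
  expand : ∀ e b r u → suc e * (2 * b + r) + e * u ≡ 2 * (suc e * b) + suc e * r + e * u
  expand = solve-∀
  regroup : ∀ e a t r u → 2 * (suc (e + e) * a + e * t) + suc e * r + e * u
                          ≡ 2 * suc (e + e) * a + suc e * r + e * (2 * t + u)
  regroup = solve-∀
  collect : ∀ e a r → 2 * suc (e + e) * a + suc e * r + e * r ≡ suc (e + e) * (r + 2 * a)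
  collect = solve-∀

gℕ-near-central-recurrence : ∀ e k →
    (2 + e) * suc (e + e) * gℕ (2 + e) (3 + e) k + (3 + e + e) * e * shift (shift (gℕ e (1 + e))) k
    ≡ 2 * (2 * suc e * suc e * shift (gℕ (1 + e) (2 + e)) k + suc (e + e) * (3 + e + e) * gℕ (1 + e) (2 + e) k)
gℕ-near-central-recurrence e k = begin
  (2 + e) * suc (e + e) * b₂ + (3 + e + e) * e * ttb₀
    ≡⟨ cong (_+ (3 + e + e) * e * ttb₀) (swap (2 + e) (suc (e + e)) b₂) ⟩
  suc (e + e) * ((2 + e) * b₂) + (3 + e + e) * e * ttb₀
    ≡⟨ cong (λ x → suc (e + e) * x + (3 + e + e) * e * ttb₀) (gℕ-near-central-step (suc e) k) ⟩
  suc (e + e) * (s * a₂ + suc e * tb₁) + (3 + e + e) * e * ttb₀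
    ≡⟨ cong (λ x → suc (e + e) * (s * x + suc e * tb₁) + (3 + e + e) * e * ttb₀) (gℕ-central-step e k) ⟩
  suc (e + e) * (s * (2 * b₁ + ta₁) + suc e * tb₁) + (3 + e + e) * e * ttb₀
    ≡⟨ regroup e b₁ ta₁ tb₁ ttb₀ ⟩
  s * (suc (e + e) * ta₁ + e * ttb₀) + rest
    ≡⟨ cong (λ x → s * x + rest) (shift-near-central-step e k) ⟨
  s * (suc e * tb₁) + rest
    ≡⟨ collect e b₁ tb₁ ⟩
  2 * (2 * suc e * suc e * tb₁ + suc (e + e) * (3 + e + e) * b₁)
    ∎
  where
  b₂ = gℕ (2 + e) (3 + e) k
  b₁ = gℕ (1 + e) (2 + e) k
  a₂ = gℕ (2 + e) (2 + e) k
  tb₁ = shift (gℕ (1 + e) (2 + e)) k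
  ttb₀ = shift (shift (gℕ e (1 + e))) k
  ta₁ = shift (gℕ (1 + e) (1 + e)) k
  s = suc (suc e + suc e)
  rest = 2 * (suc (e + e) * s) * b₁ + suc (e + e) * (suc e * tb₁)
  swap : ∀ x y z → x * y * z ≡ y * (x * z)
  swap = solve-∀
  regroup : ∀ e b ta tb ttb → suc (e + e) * (suc (suc e + suc e) * (2 * b + ta) + suc e * tb) + (3 + e + e) * e * ttb
            ≡ suc (suc e + suc e) * (suc (e + e) * ta + e * ttb)
              + (2 * (suc (e + e) * suc (suc e + suc e)) * b + suc (e + e) * (suc e * tb))
  regroup = solve-∀
  collect : ∀ e b tb → suc (suc e + suc e) * (suc e * tb)
                       + (2 * (suc (e + e) * suc (suc e + suc e)) * b + suc (e + e) * (suc e * tb))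
            ≡ 2 * (2 * suc e * suc e * tb + suc (e + e) * (3 + e + e) * b)
  collect = solve-∀

numerator-index : ∀ {c d e} → c < d → c < e → d + e ∸ suc c ∸ 1 ≡ (d ∸ suc c) + (e ∸ suc c) + c
numerator-index {c} {d} {e} c<d c<e = begin
  d + e ∸ suc c ∸ 1                    ≡⟨ cong₂ (λ x y → x + y ∸ suc c ∸ 1) (m∸n+n≡m c<d) (m∸n+n≡m c<e) ⟨
  a + suc c + (b + suc c) ∸ suc c ∸ 1  ≡⟨ cong (λ x → x ∸ suc c ∸ 1) (regroup a b c) ⟩
  suc (a + b + c) + suc c ∸ suc c ∸ 1  ≡⟨ cong (_∸ 1) (m+n∸n≡m (suc (a + b + c)) (suc c)) ⟩
  a + b + c                            ∎
  where
  a = d ∸ suc c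
  b = e ∸ suc c
  regroup : ∀ a b c → a + suc c + (b + suc c) ≡ suc (a + b + c) + suc c
  regroup = solve-∀

gℕ-inside : ∀ {c d e} → c < d → c < e → gℕ d e (suc c) ≡ trinomial (d ∸ suc c) (e ∸ suc c) c
gℕ-inside c<d c<e rewrite +-∸-assoc 1 c<d | +-∸-assoc 1 c<e = refl

gℕ-outside : ∀ {c d e} → ¬ (c < d ⊓ e) → gℕ d e (suc c) ≡ 0
gℕ-outside {c} {d} {e} c≮d⊓e with c <? d | c <? e
... | no c≮d  | _       rewrite m≤n⇒m∸n≡0 (≮⇒≥ c≮d) = refl
... | yes c<d | no c≮e  rewrite +-∸-assoc 1 c<d | m≤n⇒m∸n≡0 (≮⇒≥ c≮e) = refl
... | yes c<d | yes c<e = contradiction (⊓-pres-m< c<d c<e) c≮d⊓e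

⟦_⟧ : (ℕ → ℕ) → Poly
⟦ f ⟧ k = ℕ→ℚ (f k)

g≈gℕ : ∀ d e → g (d + e) d ≈ₚ ⟦ gℕ d e ⟧
g≈gℕ d e zero = refl
g≈gℕ d e (suc c) rewrite m+n∸m≡n d e with suc c ≤ᵇ d ⊓ e | ≤ᵇ-reflects-≤ (suc c) (d ⊓ e)
... | false | ofⁿ c≮d⊓e = cong ℕ→ℚ (sym (gℕ-outside c≮d⊓e))
... | true  | ofʸ c<d⊓e = begin
  ℕ→ℚ ((d + e ∸ suc c ∸ 1) !) /ℕ p              ≡⟨ cong (λ n → ℕ→ℚ (n !) /ℕ p) (numerator-index c<d c<e) ⟩
  ℕ→ℚ ((a + b + c) !) /ℕ p                      ≡⟨ cong (λ n → ℕ→ℚ n /ℕ p) (trinomial-! a b c) ⟨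
  ℕ→ℚ (trinomial a b c * p) /ℕ p                ≡⟨ ℕ→ℚ-*-/ℕ (trinomial a b c) p {{factorials≢0 a b c}} ⟩
  ℕ→ℚ (trinomial a b c)                         ≡⟨ cong ℕ→ℚ (gℕ-inside c<d c<e) ⟨
  ℕ→ℚ (gℕ d e (suc c))                          ∎
  where
  c<d = m<n⊓o⇒m<n d e c<d⊓e
  c<e = m<n⊓o⇒m<o d e c<d⊓e
  a = d ∸ suc c
  b = e ∸ suc c
  p = a ! * b ! * c !

g≈gℕ-at : ∀ {n d} d′ e → d ≡ d′ → n ≡ d′ + e → g n d ≈ₚ ⟦ gℕ d′ e ⟧
g≈gℕ-at d′ e refl refl = g≈gℕ d′ e

t·-⟦⟧ : ∀ {p f} → p ≈ₚ ⟦ f ⟧ → t· p ≈ₚ ⟦ shift f ⟧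
t·-⟦⟧ p≈f zero    = refl
t·-⟦⟧ p≈f (suc k) = p≈f k

twice-suc : ∀ e → 2 * suc e ≡ 2 + (e + e)
twice-suc = solve-∀

twice-suc∸1 : ∀ e → 2 * suc e ∸ 1 ≡ suc (e + e)
twice-suc∸1 e = cong (_∸ 1) (twice-suc e)

g[2d,d] : ∀ d → g (2 * d) d ≈ₚ ⟦ gℕ d d ⟧
g[2d,d] d = g≈gℕ-at d d refl (n≡ d)
  where
  n≡ : ∀ d → 2 * d ≡ d + d
  n≡ = solve-∀

g[2d+1,d] : ∀ d → g (2 * d + 1) d ≈ₚ ⟦ gℕ d (suc d) ⟧
g[2d+1,d] d = g≈gℕ-at d (suc d) refl (n≡ d)
  where
  n≡ : ∀ d → 2 * d + 1 ≡ d + suc d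
  n≡ = solve-∀

g[2d+2,d+1] : ∀ d → g (2 * d + 2) (d + 1) ≈ₚ ⟦ gℕ (suc d) (suc d) ⟧
g[2d+2,d+1] d = g≈gℕ-at (suc d) (suc d) (+-comm d 1) (n≡ d)
  where
  n≡ : ∀ d → 2 * d + 2 ≡ suc d + suc d
  n≡ = solve-∀

g[2d+3,d+1] : ∀ d → g (2 * d + 3) (d + 1) ≈ₚ ⟦ gℕ (suc d) (2 + d) ⟧
g[2d+3,d+1] d = g≈gℕ-at (suc d) (2 + d) (+-comm d 1) (n≡ d)
  where
  n≡ : ∀ d → 2 * d + 3 ≡ suc d + (2 + d)
  n≡ = solve-∀

g[2d-2,d-1] : ∀ e → g (2 * suc e ∸ 2) e ≈ₚ ⟦ gℕ e e ⟧
g[2d-2,d-1] e = g≈gℕ-at e e refl (cong (_∸ 2) (twice-suc e))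

g[2d-1,d-1] : ∀ e → g (2 * suc e ∸ 1) e ≈ₚ ⟦ gℕ e (suc e) ⟧
g[2d-1,d-1] e = g≈gℕ-at e (suc e) refl (trans (twice-suc∸1 e) (sym (+-suc e e)))

g-central-recurrence : ∀ d → 1 ≤ d →
    g (2 * d + 2) (d + 1)
      ≈ₚ (ℕ→ℚ (2 * d ∸ 1) /ℕ d) ·ₚ (t· g (2 * d) d +ₚ ℕ→ℚ 2 ·ₚ g (2 * d) d)
         -ₚ (ℕ→ℚ (d ∸ 1) /ℕ d) ·ₚ t· t· g (2 * d ∸ 2) (d ∸ 1)
g-central-recurrence (suc e) _ k = begin
  g (2 * suc e + 2) (suc e + 1) k
    ≡⟨ g[2d+2,d+1] (suc e) k ⟩
  ℕ→ℚ (gℕ (2 + e) (2 + e) k)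
    ≡⟨ ℕ→ℚ-solve-− (suc e) (2 * suc e ∸ 1) e eq ⟩
  α ℚ.* ℕ→ℚ w ℚ.- β ℚ.* ℕ→ℚ (shift (shift (gℕ e e)) k)
    ≡⟨ cong₂ (λ x y → α ℚ.* x ℚ.- β ℚ.* y) w≡ (sym (t·-⟦⟧ (t·-⟦⟧ (g[2d-2,d-1] e)) k)) ⟩
  α ℚ.* ((t· g (2 * suc e) (suc e)) k ℚ.+ ℕ→ℚ 2 ℚ.* g (2 * suc e) (suc e) k) ℚ.- β ℚ.* (t· t· g (2 * suc e ∸ 2) e) k
    ∎
  where
  α = ℕ→ℚ (2 * suc e ∸ 1) /ℕ suc e
  β = ℕ→ℚ e /ℕ suc e
  a₁ = gℕ (1 + e) (1 + e)
  w = shift a₁ k + 2 * a₁ k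
  eq : suc e * gℕ (2 + e) (2 + e) k + e * shift (shift (gℕ e e)) k ≡ (2 * suc e ∸ 1) * w
  eq = trans (gℕ-central-recurrence e k) (cong (_* w) (sym (twice-suc∸1 e)))
  w≡ : ℕ→ℚ w ≡ (t· g (2 * suc e) (suc e)) k ℚ.+ ℕ→ℚ 2 ℚ.* g (2 * suc e) (suc e) k
  w≡ = trans (ℕ→ℚ-+ (shift a₁ k) (2 * a₁ k))
             (cong₂ ℚ._+_ (sym (t·-⟦⟧ (g[2d,d] (suc e)) k))
                          (trans (ℕ→ℚ-* 2 (a₁ k)) (cong (ℕ→ℚ 2 ℚ.*_) (sym (g[2d,d] (suc e) k)))))

g-near-central-recurrence : ∀ d → 1 ≤ d →
    g (2 * d + 3) (d + 1)
      ≈ₚ (ℕ→ℚ 2 /ℕ ((d + 1) * (2 * d ∸ 1)))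
           ·ₚ (ℕ→ℚ (2 * d * d) ·ₚ t· g (2 * d + 1) d +ₚ ℕ→ℚ (4 * d * d ∸ 1) ·ₚ g (2 * d + 1) d)
         -ₚ (ℕ→ℚ ((2 * d + 1) * (d ∸ 1)) /ℕ ((d + 1) * (2 * d ∸ 1))) ·ₚ t· t· g (2 * d ∸ 1) (d ∸ 1)
g-near-central-recurrence (suc e) _ k = begin
  g (2 * suc e + 3) (suc e + 1) k
    ≡⟨ g[2d+3,d+1] (suc e) k ⟩
  ℕ→ℚ (gℕ (2 + e) (3 + e) k)
    ≡⟨ ℕ→ℚ-solve-− D {w = w} 2 β {{D≢0}} eq ⟩
  α ℚ.* ℕ→ℚ w ℚ.- γ ℚ.* ℕ→ℚ (shift (shift (gℕ e (1 + e))) k)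
    ≡⟨ cong₂ (λ x y → α ℚ.* x ℚ.- γ ℚ.* y) w≡ (sym (t·-⟦⟧ (t·-⟦⟧ (g[2d-1,d-1] e)) k)) ⟩
  α ℚ.* (ℕ→ℚ c ℚ.* (t· g (2 * suc e + 1) (suc e)) k ℚ.+ ℕ→ℚ f ℚ.* g (2 * suc e + 1) (suc e) k)
    ℚ.- γ ℚ.* (t· t· g (2 * suc e ∸ 1) e) k
    ∎
  where
  D = (suc e + 1) * (2 * suc e ∸ 1)
  β = (2 * suc e + 1) * e
  c = 2 * suc e * suc e
  f = 4 * suc e * suc e ∸ 1
  α = ℕ→ℚ 2 /ℕ D
  γ = ℕ→ℚ β /ℕ D
  b₁ = gℕ (1 + e) (2 + e)
  w = c * shift b₁ k + f * b₁ k
  D≡ : D ≡ (2 + e) * suc (e + e)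
  D≡ = cong₂ _*_ (+-comm (suc e) 1) (twice-suc∸1 e)
  D≢0 : NonZero D
  D≢0 = subst NonZero (sym D≡) _
  β≡ : β ≡ (3 + e + e) * e
  β≡ = cong (_* e) (n≡ e)
    where
    n≡ : ∀ e → 2 * suc e + 1 ≡ 3 + e + e
    n≡ = solve-∀
  f≡ : f ≡ suc (e + e) * (3 + e + e)
  f≡ = cong (_∸ 1) (n≡ e)
    where
    n≡ : ∀ e → 4 * suc e * suc e ≡ suc (suc (e + e) * (3 + e + e))
    n≡ = solve-∀
  eq : D * gℕ (2 + e) (3 + e) k + β * shift (shift (gℕ e (1 + e))) k ≡ 2 * w
  eq = begin
    D * gℕ (2 + e) (3 + e) k + β * shift (shift (gℕ e (1 + e))) k
      ≡⟨ cong₂ (λ x y → x * gℕ (2 + e) (3 + e) k + y * shift (shift (gℕ e (1 + e))) k) D≡ β≡ ⟩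
    (2 + e) * suc (e + e) * gℕ (2 + e) (3 + e) k + (3 + e + e) * e * shift (shift (gℕ e (1 + e))) k
      ≡⟨ gℕ-near-central-recurrence e k ⟩
    2 * (c * shift b₁ k + suc (e + e) * (3 + e + e) * b₁ k)
      ≡⟨ cong (λ x → 2 * (c * shift b₁ k + x * b₁ k)) f≡ ⟨
    2 * w
      ∎
  w≡ : ℕ→ℚ w ≡ ℕ→ℚ c ℚ.* (t· g (2 * suc e + 1) (suc e)) k ℚ.+ ℕ→ℚ f ℚ.* g (2 * suc e + 1) (suc e) k
  w≡ = trans (ℕ→ℚ-linear c (shift b₁ k) f (b₁ k))
             (cong₂ (λ x y → ℕ→ℚ c ℚ.* x ℚ.+ ℕ→ℚ f ℚ.* y)
                    (sym (t·-⟦⟧ (g[2d+1,d] (suc e)) k)) (sym (g[2d+1,d] (suc e) k)))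

g-near-central-step : ∀ d → 1 ≤ d →
    g (2 * d + 1) d
      ≈ₚ (ℕ→ℚ (2 * d ∸ 1) /ℕ d) ·ₚ g (2 * d) d +ₚ (ℕ→ℚ (d ∸ 1) /ℕ d) ·ₚ t· g (2 * d ∸ 1) (d ∸ 1)
g-near-central-step (suc e) _ k = begin
  g (2 * suc e + 1) (suc e) k
    ≡⟨ g[2d+1,d] (suc e) k ⟩
  ℕ→ℚ (gℕ (1 + e) (2 + e) k)
    ≡⟨ ℕ→ℚ-solve-+ (suc e) (2 * suc e ∸ 1) e eq ⟩
  α ℚ.* ℕ→ℚ (gℕ (1 + e) (1 + e) k) ℚ.+ β ℚ.* ℕ→ℚ (shift (gℕ e (1 + e)) k)
    ≡⟨ cong₂ (λ x y → α ℚ.* x ℚ.+ β ℚ.* y) (sym (g[2d,d] (suc e) k)) (sym (t·-⟦⟧ (g[2d-1,d-1] e) k)) ⟩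
  α ℚ.* g (2 * suc e) (suc e) k ℚ.+ β ℚ.* (t· g (2 * suc e ∸ 1) e) k
    ∎
  where
  α = ℕ→ℚ (2 * suc e ∸ 1) /ℕ suc e
  β = ℕ→ℚ e /ℕ suc e
  eq : suc e * gℕ (1 + e) (2 + e) k ≡ (2 * suc e ∸ 1) * gℕ (1 + e) (1 + e) k + e * shift (gℕ e (1 + e)) k
  eq = trans (gℕ-near-central-step e k)
             (cong (λ x → x * gℕ (1 + e) (1 + e) k + e * shift (gℕ e (1 + e)) k) (sym (twice-suc∸1 e)))

g-central-step : ∀ d → 1 ≤ d → g (2 * d + 2) (d + 1) ≈ₚ ℕ→ℚ 2 ·ₚ g (2 * d + 1) d +ₚ t· g (2 * d) d
g-central-step (suc e) _ k = begin
  g (2 * suc e + 2) (suc e + 1) k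
    ≡⟨ g[2d+2,d+1] (suc e) k ⟩
  ℕ→ℚ (gℕ (2 + e) (2 + e) k)
    ≡⟨ cong ℕ→ℚ (gℕ-central-step e k) ⟩
  ℕ→ℚ (2 * b₁ k + shift a₁ k)
    ≡⟨ trans (ℕ→ℚ-+ (2 * b₁ k) (shift a₁ k)) (cong (ℚ._+ ℕ→ℚ (shift a₁ k)) (ℕ→ℚ-* 2 (b₁ k))) ⟩
  ℕ→ℚ 2 ℚ.* ℕ→ℚ (b₁ k) ℚ.+ ℕ→ℚ (shift a₁ k)
    ≡⟨ cong₂ (λ x y → ℕ→ℚ 2 ℚ.* x ℚ.+ y) (sym (g[2d+1,d] (suc e) k)) (sym (t·-⟦⟧ (g[2d,d] (suc e)) k)) ⟩
  ℕ→ℚ 2 ℚ.* g (2 * suc e + 1) (suc e) k ℚ.+ (t· g (2 * suc e) (suc e)) k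
    ∎
  where
  b₁ = gℕ (1 + e) (2 + e)
  a₁ = gℕ (1 + e) (1 + e)

theorem2p4 : ∀ (d : ℕ) → 1 ≤ d →
    (g (2 ℕ.* d ℕ.+ 2) (d ℕ.+ 1)
      ≈ₚ (ℕ→ℚ (2 ℕ.* d ∸ 1) /ℕ d) ·ₚ (t· g (2 ℕ.* d) d +ₚ ℕ→ℚ 2 ·ₚ g (2 ℕ.* d) d)
         -ₚ (ℕ→ℚ (d ∸ 1) /ℕ d) ·ₚ t· t· g (2 ℕ.* d ∸ 2) (d ∸ 1))
  × (g (2 ℕ.* d ℕ.+ 3) (d ℕ.+ 1)
      ≈ₚ (ℕ→ℚ 2 /ℕ ((d ℕ.+ 1) ℕ.* (2 ℕ.* d ∸ 1)))
           ·ₚ (ℕ→ℚ (2 ℕ.* d ℕ.* d) ·ₚ t· g (2 ℕ.* d ℕ.+ 1) d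
               +ₚ ℕ→ℚ (4 ℕ.* d ℕ.* d ∸ 1) ·ₚ g (2 ℕ.* d ℕ.+ 1) d)
         -ₚ (ℕ→ℚ ((2 ℕ.* d ℕ.+ 1) ℕ.* (d ∸ 1)) /ℕ ((d ℕ.+ 1) ℕ.* (2 ℕ.* d ∸ 1)))
           ·ₚ t· t· g (2 ℕ.* d ∸ 1) (d ∸ 1))
  × (g (2 ℕ.* d ℕ.+ 1) d
      ≈ₚ (ℕ→ℚ (2 ℕ.* d ∸ 1) /ℕ d) ·ₚ g (2 ℕ.* d) d
         +ₚ (ℕ→ℚ (d ∸ 1) /ℕ d) ·ₚ t· g (2 ℕ.* d ∸ 1) (d ∸ 1))
  × (g (2 ℕ.* d ℕ.+ 2) (d ℕ.+ 1)
      ≈ₚ ℕ→ℚ 2 ·ₚ g (2 ℕ.* d ℕ.+ 1) d +ₚ t· g (2 ℕ.* d) d)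
theorem2p4 d 1≤d =
    g-central-recurrence d 1≤d
  , g-near-central-recurrence d 1≤d
  , g-near-central-step d 1≤d
  , g-central-step d 1≤d
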